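{- Let $\mathcal{A}=(\Sigma,Q,F,\Delta)$ be a $T$-shaped tree automaton. A vector $\mu$ over $\mathrm{var}(\mathcal{A})$ belongs to $P_{ex}(\mathcal{A})$ if and only if $\mu$ satisfies all constraints of the system $\mathfrak{L}_{\mathcal{A}}$.
   Context: An addressed tree $T$ is a rooted tree with node set $N(T)$, root $r$, children of each node numbered $1,\dots,s$; $\mathrm{par}(u)$ denotes the parent of $u\ne r$. $\Sigma$ is a finite alphabet; a $T$-shaped term is a map $\tau:N(T)\to\Sigma$. A $T$-shaped tree automaton $\mathcal{A}=(\Sigma,Q,F,\Delta)$ has states $Q$ partitioned into cells $\{Q_u\}_{u\in N(T)}$, final states $F\subseteq Q_r$, and transitions $\Delta$ partitioned into $\{\Delta_u\}$ with $\Delta_u\subseteq Q_{u_1}\times\dots\times Q_{u_s}\times\Sigma\times Q_u$ ($u_1,\dots,u_s$ the children of $u$ in order). A trace for $\tau$ is $\rho:N(T)\to Q$ with $(\rho(u_1),\dots,\rho(u_s),\tau(u),\rho(u))\in\Delta_u$ for every $u$; it is accepting if $\rho(r)\in F$; $\mathcal{L}(\mathcal{A})$ is the set of terms with an accepting trace. For $\delta=(q_1,\dots,q_s,a,q)$ let $\mathrm{cnq}(\delta)=q$, $\mathrm{ant}(\delta)=\{q_1,\dots,q_s\}$, $\mathrm{symb}(\delta)=a$. Variables: $\mathrm{var}(\mathcal{A})$ consists of $x_{u,a}$ ($u\in N(T)$, $a\in\Sigma$), $y_{u,q}$ ($u\in N(T)$, $q\in Q_u$), $z_{u,\delta}$ ($u\in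 N(T)$, $\delta\in\Delta_u$). The system $\mathfrak{L}_{\mathcal{A}}$ consists of: (i) $0\le x_{u,a}\le1$, $0\le y_{u,q}\le1$, $0\le z_{u,\delta}\le1$ for all variables; (ii) $\sum_{q\in F}y_{r,q}=1$; (iii) $y_{r,q}=0$ for all $q\in Q_r\setminus F$; (iv) for all $u$ and $q\in Q_u$: $\sum_{\delta\in\Delta_u,\mathrm{cnq}(\delta)=q}z_{u,\delta}=y_{u,q}$; (v) for all $u\ne r$ and $q\in Q_u$: $\sum_{\delta\in\Delta_{\mathrm{par}(u)},q\in\mathrm{ant}(\delta)}z_{\mathrm{par}(u),\delta}=y_{u,q}$; (vi) for all $u$ and $a\in\Sigma$: $\sum_{\delta\in\Delta_u,\mathrm{symb}(\delta)=a}z_{u,\delta}=x_{u,a}$. For a term $\tau$ and a trace $\rho$ for $\tau$, $\hat\rho$ is the 0/1 vector over $\mathrm{var}(\mathcal{A})$ with $\hat\rho(x_{u,a})=1$ iff $\tau(u)=a$; $\hat\rho(y_{u,q})=1$ iff $\rho(u)=q$; $\hat\rho(z_{u,\delta})=1$ iff $\delta=(\rho(u_1),\dots,\rho(u_s),\tau(u),\rho(u))$ where $u_1,\dots,u_s$ are the children of $u$. $P_{ex}(\mathcal{A})=\mathrm{conv}\{\hat\rho:\rho\text{ an accepting trace (of some term) in }\mathcal{A}\}$.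
   Formalization: The vectors μ over $\mathrm{var}(\mathcal{A})$ have rational entries, and the convex combinations defining $P_{ex}(\mathcal{A})$ use rational weights. -}

module Defs where

open import Data.Nat using (ℕ; zero; suc)
open import Data.Fin using (Fin; zero; suc; _≟_)
open import Data.Fin.Properties using (all?)
open import Data.Bool using (Bool; true; false; if_then_else_)
open import Data.Product using (Σ; ∃; ∃-syntax; _×_; _,_)
open import Data.Rational using (ℚ; 0ℚ; 1ℚ; _+_; _*_; _≤_)
open import Relation.Nullary using (Dec; yes; no)
open import Relation.Nullary.Decidable using (⌊_⌋; _×-dec_)
open import Relation.Binary.PropositionalEquality using (_≡_)

-- Addressed trees: a node has s children, numbered (here 0,…,s-1).

data Tree : Set where
  node : (s : ℕ) → (Fin s → Tree) → Tree

data Node : Tree → Set where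
  here  : ∀ {s ts} → Node (node s ts)
  there : ∀ {s ts} (i : Fin s) → Node (ts i) → Node (node s ts)

root : {t : Tree} → Node t
root {node s ts} = here

arity : {t : Tree} → Node t → ℕ
arity {node s ts} here = s
arity (there i p) = arity p

child : {t : Tree} (u : Node t) → Fin (arity u) → Node t
child {node s ts} here i = there i root
child (there j p) i = there j (child p i)

∑ : (n : ℕ) → (Fin n → ℚ) → ℚ
∑ zero    f = 0ℚ
∑ (suc n) f = f zero + ∑ n (λ i → f (suc i))

∑[_∣_] : {n : ℕ} → (Fin n → Bool) → (Fin n → ℚ) → ℚ
∑[_∣_] {n} c f = ∑ n (λ i → if c i then f i else 0ℚ)

indicator : Bool → ℚ
indicator b = if b then 1ℚ else 0ℚ

-- T-shaped tree automata.
-- Σ = Fin nΣ ; cell Q_u = Fin (nQ u) ; Δ_u = {Δ u j | j : Fin (nΔ u)}.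

-- an element of Q_{u_1} × … × Q_{u_s} × Σ × Q_u
record Transition {t : Tree} (nΣ : ℕ) (nQ : Node t → ℕ) (u : Node t) : Set where
  constructor trans
  field
    ant  : (i : Fin (arity u)) → Fin (nQ (child u i))
    symb : Fin nΣ
    cnq  : Fin (nQ u)
open Transition public

SameTransition : {t : Tree} {nΣ : ℕ} {nQ : Node t → ℕ} {u : Node t} →
                 Transition nΣ nQ u → Transition nΣ nQ u → Set
SameTransition δ δ' =
  (∀ i → ant δ i ≡ ant δ' i) × (symb δ ≡ symb δ') × (cnq δ ≡ cnq δ')

record TreeAutomaton (t : Tree) : Set where
  field
    nΣ : ℕ
    nQ : Node t → ℕ
    F  : Fin (nQ root) → Bool
    nΔ : Node t → ℕ
    Δ  : (u : Node t) → Fin (nΔ u) → Transition nΣ nQ u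
    -- Δ_u is a set: the enumeration has no repetitions
    Δ-distinct : ∀ u (j k : Fin (nΔ u)) → SameTransition (Δ u j) (Δ u k) → j ≡ k

module _ {t : Tree} (A : TreeAutomaton t) where
  open TreeAutomaton A

  -- vectors over var(A): coordinates x_{u,a}, y_{u,q}, z_{u,δ}
  record Vector : Set where
    field
      x : (u : Node t) → Fin nΣ → ℚ
      y : (u : Node t) → Fin (nQ u) → ℚ
      z : (u : Node t) → Fin (nΔ u) → ℚ
  open Vector public

  Term : Set
  Term = Node t → Fin nΣ

  StateMap : Set
  StateMap = (u : Node t) → Fin (nQ u)

  Fits : (τ : Term) (ρ : StateMap) (u : Node t) → Transition nΣ nQ u → Set
  Fits τ ρ u δ = (∀ i → ant δ i ≡ ρ (child u i)) × (symb δ ≡ τ u) × (cnq δ ≡ ρ u)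

  fits? : (τ : Term) (ρ : StateMap) (u : Node t) (δ : Transition nΣ nQ u) → Dec (Fits τ ρ u δ)
  fits? τ ρ u δ = all? (λ i → ant δ i ≟ ρ (child u i)) ×-dec (symb δ ≟ τ u ×-dec cnq δ ≟ ρ u)

  IsTrace : Term → StateMap → Set
  IsTrace τ ρ = ∀ u → ∃[ j ] Fits τ ρ u (Δ u j)

  IsAcceptingTrace : Term → StateMap → Set
  IsAcceptingTrace τ ρ = IsTrace τ ρ × (F (ρ root) ≡ true)

  hat : Term → StateMap → Vector
  x (hat τ ρ) u a = indicator ⌊ τ u ≟ a ⌋
  y (hat τ ρ) u q = indicator ⌊ ρ u ≟ q ⌋
  z (hat τ ρ) u j = indicator ⌊ fits? τ ρ u (Δ u j) ⌋

  IsCombination : Vector → (k : ℕ) → (Fin k → ℚ) → (Fin k → Term) → (Fin k → StateMap) → Set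
  IsCombination μ k λ′ τs ρs =
      (∀ u a → x μ u a ≡ ∑ k (λ l → λ′ l * x (hat (τs l) (ρs l)) u a))
    × (∀ u q → y μ u q ≡ ∑ k (λ l → λ′ l * y (hat (τs l) (ρs l)) u q))
    × (∀ u j → z μ u j ≡ ∑ k (λ l → λ′ l * z (hat (τs l) (ρs l)) u j))

  InPex : Vector → Set
  InPex μ = ∃[ k ] Σ (Fin k → ℚ) λ λ′ → Σ (Fin k → Term) λ τs → Σ (Fin k → StateMap) λ ρs →
              (∀ l → IsAcceptingTrace (τs l) (ρs l))
            × (∀ l → 0ℚ ≤ λ′ l)
            × (∑ k λ′ ≡ 1ℚ)
            × IsCombination μ k λ′ τs ρs

  Satisfies𝔏 : Vector → Set
  Satisfies𝔏 μ =
      -- (i)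
      ((∀ u a → 0ℚ ≤ x μ u a × x μ u a ≤ 1ℚ)
     × (∀ u q → 0ℚ ≤ y μ u q × y μ u q ≤ 1ℚ)
     × (∀ u j → 0ℚ ≤ z μ u j × z μ u j ≤ 1ℚ))
      -- (ii)
    × (∑[ F ∣ y μ root ] ≡ 1ℚ)
      -- (iii)
    × (∀ q → F q ≡ false → y μ root q ≡ 0ℚ)
      -- (iv)
    × (∀ u q → ∑[ (λ j → ⌊ cnq (Δ u j) ≟ q ⌋) ∣ z μ u ] ≡ y μ u q)
      -- (v)  (every non-root node is child u i with par = u)
    × (∀ u i q → ∑[ (λ j → ⌊ ant (Δ u j) i ≟ q ⌋) ∣ z μ u ] ≡ y μ (child u i) q)
      -- (vi)
    × (∀ u a → ∑[ (λ j → ⌊ symb (Δ u j) ≟ a ⌋) ∣ z μ u ] ≡ x μ u a)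

-- Each ρ̂ of an accepting trace has 0/1 entries and satisfies (ii)–(vi) with right-hand side 1;
-- these constraints are linear, so every convex combination of such vectors satisfies 𝔏_A.
--
-- Conversely, let μ ≥ 0 satisfy (ii)–(vi) with right-hand side c > 0. By (ii) some final state
-- has positive weight at the root, by (iv) some transition concluding in it has positive weight,
-- and by (v) its antecedents have positive weight at the children. Descending the tree in this
-- way gives an accepting trace ρ all of whose transitions have positive weight. If ε is the
-- least of these weights, μ − ε ρ̂ is again nonnegative, satisfies (ii)–(vi) with right-hand
-- side c − ε, and has fewer positive z-coordinates. Induction on their number ends with c ≤ 0,
-- where (ii), (iv) and (v) force μ = 0.
module Submission where

open import Defs hiding (trans)
open import Algebra.Bundles using (CommutativeMonoid)
open import Data.Bool using (Bool; true; false; if_then_else_)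
open import Data.Bool.Properties using (T-≡; T-not-≡; if-eta)
open import Data.Fin using (Fin; zero; suc; _≟_)
open import Data.Fin.Properties using (any?)
open import Data.Fin.Subset using (Subset; _⊆_; _⊂_; ∣_∣) renaming (_∈_ to _∈ˢ_)
open import Data.Fin.Subset.Properties using (p⊆q⇒∣p∣≤∣q∣; p⊂q⇒∣p∣<∣q∣)
import Data.List as List
open import Data.List.Relation.Unary.All.Properties using (tabulate⁻)
import Data.List.Extrema
open import Data.Nat as ℕ using (ℕ; zero; suc)
import Data.Nat.Properties as ℕₚ
open import Data.Nat.Induction using (<-wellFounded)
open import Data.Product using (Σ; ∃-syntax; _×_; _,_; proj₁; proj₂)
open import Data.Rational using (ℚ; 0ℚ; 1ℚ; _+_; _*_; _-_; -_; _≤_; _<_)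
import Data.Rational.Properties as ℚₚ
open import Data.Rational.Solver using (module +-*-Solver)
open import Data.Vec using (tabulate)
open import Data.Vec.Properties using (lookup∘tabulate; lookup⇒[]=; []=⇒lookup)
open import Data.Vec.Functional using (_∷_)
open import Function using (_∘_; _⇔_; mk⇔; Equivalence)
open import Induction.WellFounded using (Acc; acc)
open import Relation.Binary.Bundles using (DecTotalOrder)
open import Relation.Binary.PropositionalEquality
open import Relation.Nullary using (¬_; yes; no; contradiction)
open import Relation.Nullary.Decidable
  using (Dec; does; ⌊_⌋; toWitness; fromWitness; fromWitnessFalse; isYes≗does; does-⇔; ⌊⌋-map′)

open import Algebra.Properties.CommutativeSemigroup
  (CommutativeMonoid.commutativeSemigroup ℚₚ.+-0-commutativeMonoid) using (interchange)

module _ {A : Set} (a? : Dec A) where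

  ⌊⌋-true : A → ⌊ a? ⌋ ≡ true
  ⌊⌋-true a = Equivalence.to T-≡ (fromWitness a)

  ⌊⌋-false : ¬ A → ⌊ a? ⌋ ≡ false
  ⌊⌋-false ¬a = Equivalence.to T-not-≡ (fromWitnessFalse ¬a)

  ⌊⌋-true⁻¹ : ⌊ a? ⌋ ≡ true → A
  ⌊⌋-true⁻¹ eq = toWitness (Equivalence.from T-≡ eq)

subtract-indicator : ∀ p q b → p + - q * indicator b ≡ (if b then p - q else p)
subtract-indicator p q true  = cong (p +_) (ℚₚ.*-identityʳ (- q))
subtract-indicator p q false = trans (cong (p +_) (ℚₚ.*-zeroʳ (- q))) (ℚₚ.+-identityʳ p)

q≤p⇒0≤p-q : ∀ {p q} → q ≤ p → 0ℚ ≤ p - q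
q≤p⇒0≤p-q {p} {q} q≤p = subst (_≤ p - q) (ℚₚ.+-inverseʳ q) (ℚₚ.+-monoˡ-≤ (- q) q≤p)

0≤q⇒p-q≤p : ∀ {p q} → 0ℚ ≤ q → p - q ≤ p
0≤q⇒p-q≤p {p} {q} 0≤q = subst (p - q ≤_) (ℚₚ.+-identityʳ p) (ℚₚ.+-monoʳ-≤ p (ℚₚ.neg-antimono-≤ 0≤q))

module _ where
  open +-*-Solver

  p+[q-p]≡q : ∀ p q → p + (q - p) ≡ q
  p+[q-p]≡q = solve 2 (λ p q → p :+ (q :+ :- p) := q) refl

  p≡q*r+[p+-q*r] : ∀ p q r → p ≡ q * r + (p + - q * r)
  p≡q*r+[p+-q*r] = solve 3 (λ p q r → p := q :* r :+ (p :+ :- q :* r)) refl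

-- Finite sums of rationals

∑-cong : ∀ n {f g : Fin n → ℚ} → f ≗ g → ∑ n f ≡ ∑ n g
∑-cong zero    f≗g = refl
∑-cong (suc n) f≗g = cong₂ _+_ (f≗g zero) (∑-cong n (f≗g ∘ suc))

∑-zero : ∀ n → ∑ n (λ _ → 0ℚ) ≡ 0ℚ
∑-zero zero    = refl
∑-zero (suc n) = trans (cong (0ℚ +_) (∑-zero n)) (ℚₚ.+-identityʳ 0ℚ)

∑-distrib-+ : ∀ n (f g : Fin n → ℚ) → ∑ n (λ i → f i + g i) ≡ ∑ n f + ∑ n g
∑-distrib-+ zero    f g = sym (ℚₚ.+-identityʳ 0ℚ)
∑-distrib-+ (suc n) f g =
  trans (cong (f zero + g zero +_) (∑-distrib-+ n (f ∘ suc) (g ∘ suc)))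
        (interchange (f zero) (g zero) _ _)

*-distribˡ-∑ : ∀ n a (f : Fin n → ℚ) → a * ∑ n f ≡ ∑ n (λ i → a * f i)
*-distribˡ-∑ zero    a f = ℚₚ.*-zeroʳ a
*-distribˡ-∑ (suc n) a f =
  trans (ℚₚ.*-distribˡ-+ a (f zero) _) (cong (a * f zero +_) (*-distribˡ-∑ n a (f ∘ suc)))

∑-mono-≤ : ∀ n {f g : Fin n → ℚ} → (∀ i → f i ≤ g i) → ∑ n f ≤ ∑ n g
∑-mono-≤ zero    f≤g = ℚₚ.≤-refl
∑-mono-≤ (suc n) f≤g = ℚₚ.+-mono-≤ (f≤g zero) (∑-mono-≤ n (f≤g ∘ suc))

∑-nonneg : ∀ n {f : Fin n → ℚ} → (∀ i → 0ℚ ≤ f i) → 0ℚ ≤ ∑ n f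
∑-nonneg n {f} f≥0 = subst (_≤ ∑ n f) (∑-zero n) (∑-mono-≤ n f≥0)

term≤∑ : ∀ n {f : Fin n → ℚ} → (∀ i → 0ℚ ≤ f i) → ∀ i → f i ≤ ∑ n f
term≤∑ (suc n) {f} f≥0 zero = begin
  f zero                    ≡⟨ ℚₚ.+-identityʳ (f zero) ⟨
  f zero + 0ℚ               ≤⟨ ℚₚ.+-monoʳ-≤ (f zero) (∑-nonneg n (f≥0 ∘ suc)) ⟩
  f zero + ∑ n (f ∘ suc)    ∎
  where open ℚₚ.≤-Reasoning
term≤∑ (suc n) {f} f≥0 (suc i) = begin
  f (suc i)                 ≤⟨ term≤∑ n (f≥0 ∘ suc) i ⟩
  ∑ n (f ∘ suc)             ≡⟨ ℚₚ.+-identityˡ _ ⟨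
  0ℚ + ∑ n (f ∘ suc)        ≤⟨ ℚₚ.+-monoˡ-≤ _ (f≥0 zero) ⟩
  f zero + ∑ n (f ∘ suc)    ∎
  where open ℚₚ.≤-Reasoning

∑-positive-term : ∀ n {f : Fin n → ℚ} → 0ℚ < ∑ n f → ∃[ i ] 0ℚ < f i
∑-positive-term n {f} 0<∑ with any? (λ i → 0ℚ ℚₚ.<? f i)
... | yes found = found
... | no  none  = contradiction (ℚₚ.<-≤-trans 0<∑ ∑≤0) (ℚₚ.<-irrefl refl)
  where
  ∑≤0 : ∑ n f ≤ 0ℚ
  ∑≤0 = ℚₚ.≤-trans (∑-mono-≤ n (λ i → ℚₚ.≮⇒≥ (none ∘ (i ,_)))) (ℚₚ.≤-reflexive (∑-zero n))

module _ {n : ℕ} (c : Fin n → Bool) where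

  private
    select-+ : ∀ b p q → (if b then p + q else 0ℚ) ≡ (if b then p else 0ℚ) + (if b then q else 0ℚ)
    select-+ true  p q = refl
    select-+ false p q = sym (ℚₚ.+-identityʳ 0ℚ)

    select-* : ∀ b a p → (if b then a * p else 0ℚ) ≡ a * (if b then p else 0ℚ)
    select-* true  a p = refl
    select-* false a p = sym (ℚₚ.*-zeroʳ a)

    select-nonneg : ∀ b {p} → 0ℚ ≤ p → 0ℚ ≤ (if b then p else 0ℚ)
    select-nonneg true  0≤p = 0≤p
    select-nonneg false 0≤p = ℚₚ.≤-refl

    select-positive : ∀ b {p} → 0ℚ < (if b then p else 0ℚ) → b ≡ true × 0ℚ < p
    select-positive true  0<p = refl , 0<p
    select-positive false 0<0 = contradiction 0<0 (ℚₚ.<-irrefl refl)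

  ∑[]-cong : {f g : Fin n → ℚ} → f ≗ g → ∑[ c ∣ f ] ≡ ∑[ c ∣ g ]
  ∑[]-cong f≗g = ∑-cong n (λ j → cong (if c j then_else 0ℚ) (f≗g j))

  ∑[]-zero : {f : Fin n → ℚ} → (∀ j → f j ≡ 0ℚ) → ∑[ c ∣ f ] ≡ 0ℚ
  ∑[]-zero f≗0 = trans (∑[]-cong f≗0) (trans (∑-cong n (λ j → if-eta (c j))) (∑-zero n))

  ∑[]-distrib-+ : ∀ (f g : Fin n → ℚ) → ∑[ c ∣ (λ j → f j + g j) ] ≡ ∑[ c ∣ f ] + ∑[ c ∣ g ]
  ∑[]-distrib-+ f g = trans (∑-cong n (λ j → select-+ (c j) (f j) (g j))) (∑-distrib-+ n _ _)

  ∑[]-* : ∀ a (f : Fin n → ℚ) → ∑[ c ∣ (λ j → a * f j) ] ≡ a * ∑[ c ∣ f ]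
  ∑[]-* a f = trans (∑-cong n (λ j → select-* (c j) a (f j))) (sym (*-distribˡ-∑ n a _))

  ∑[]-nonneg : {f : Fin n → ℚ} → (∀ j → 0ℚ ≤ f j) → 0ℚ ≤ ∑[ c ∣ f ]
  ∑[]-nonneg f≥0 = ∑-nonneg n (λ j → select-nonneg (c j) (f≥0 j))

  term≤∑[] : {f : Fin n → ℚ} → (∀ j → 0ℚ ≤ f j) → ∀ j → c j ≡ true → f j ≤ ∑[ c ∣ f ]
  term≤∑[] {f} f≥0 j cj =
    subst (λ b → (if b then f j else 0ℚ) ≤ ∑[ c ∣ f ]) cj
          (term≤∑ n (λ j → select-nonneg (c j) (f≥0 j)) j)

  ∑[]-positive-term : {f : Fin n → ℚ} → 0ℚ < ∑[ c ∣ f ] → ∃[ j ] (c j ≡ true × 0ℚ < f j)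
  ∑[]-positive-term 0<∑ with ∑-positive-term n 0<∑
  ... | j , 0<fj = j , select-positive (c j) 0<fj

∑[]-indicator : ∀ {n} (c : Fin n → Bool) d → ∑[ c ∣ (λ j → indicator ⌊ d ≟ j ⌋) ] ≡ indicator (c d)
∑[]-indicator c zero =
  trans (cong (indicator (c zero) +_) (∑[]-zero (c ∘ suc) (λ _ → refl))) (ℚₚ.+-identityʳ _)
∑[]-indicator c (suc d) = begin
  (if c zero then 0ℚ else 0ℚ) + ∑[ c ∘ suc ∣ (λ j → indicator ⌊ suc d ≟ suc j ⌋) ]
    ≡⟨ cong₂ _+_ (if-eta (c zero))
                 (∑[]-cong (c ∘ suc) (λ j → cong indicator (⌊⌋-map′ _ _ (d ≟ j)))) ⟩
  0ℚ + ∑[ c ∘ suc ∣ (λ j → indicator ⌊ d ≟ j ⌋) ]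
    ≡⟨ cong (0ℚ +_) (∑[]-indicator (c ∘ suc) d) ⟩
  0ℚ + indicator (c (suc d))
    ≡⟨ ℚₚ.+-identityˡ _ ⟩
  indicator (c (suc d)) ∎
  where open ≡-Reasoning

*-indicator-bounds : ∀ r b → 0ℚ ≤ r → 0ℚ ≤ r * indicator b × r * indicator b ≤ r
*-indicator-bounds r true  0≤r =
  subst (λ s → 0ℚ ≤ s × s ≤ r) (sym (ℚₚ.*-identityʳ r)) (0≤r , ℚₚ.≤-refl)
*-indicator-bounds r false 0≤r =
  subst (λ s → 0ℚ ≤ s × s ≤ r) (sym (ℚₚ.*-zeroʳ r)) (ℚₚ.≤-refl , 0≤r)

convex-indicator-bounds : ∀ k (λs : Fin k → ℚ) (bs : Fin k → Bool) →
                          (∀ l → 0ℚ ≤ λs l) → ∑ k λs ≡ 1ℚ →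
                          0ℚ ≤ ∑ k (λ l → λs l * indicator (bs l))
                        × ∑ k (λ l → λs l * indicator (bs l)) ≤ 1ℚ
convex-indicator-bounds k λs bs λs≥0 ∑λs≡1 =
  ∑-nonneg k (proj₁ ∘ bounds) , ℚₚ.≤-trans (∑-mono-≤ k (proj₂ ∘ bounds)) (ℚₚ.≤-reflexive ∑λs≡1)
  where
  bounds : ∀ l → 0ℚ ≤ λs l * indicator (bs l) × λs l * indicator (bs l) ≤ λs l
  bounds l = *-indicator-bounds (λs l) (bs l) (λs≥0 l)

-- Recursion, minima and sums over the nodes of a tree

topDown : ∀ {t} (P : Node t → Set) → P root → (∀ u i → P u → P (child u i)) → ∀ u → P u
topDown {node s ts} P base step here        = base
topDown {node s ts} P base step (there i p) =
  topDown (P ∘ there i) (step here i base) (step ∘ there i) p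

topDown-root : ∀ {t} (P : Node t → Set) base step → topDown P base step root ≡ base
topDown-root {node s ts} P base step = refl

topDown-child : ∀ {t} (P : Node t → Set) base step u i →
                topDown P base step (child u i) ≡ step u i (topDown P base step u)
topDown-child {node s ts} P base step here i =
  topDown-root (P ∘ there i) (step here i base) (step ∘ there i)
topDown-child {node s ts} P base step (there j p) i =
  topDown-child (P ∘ there j) (step here j base) (step ∘ there j) p i

module _ where
  open Data.List.Extrema (DecTotalOrder.totalOrder ℚₚ.≤-decTotalOrder)
    using (argmin; f[argmin]≤f[⊤]; f[argmin]≤f[xs])

  argminᴺ : (t : Tree) → (Node t → ℚ) → Node t
  minimisersBelow : ∀ {s} (ts : Fin s → Tree) → (Node (node s ts) → ℚ) →
                    List.List (Node (node s ts))

  argminᴺ (node s ts) g = argmin g here (minimisersBelow ts g)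
  minimisersBelow ts g = List.tabulate λ i → there i (argminᴺ (ts i) (g ∘ there i))

  argminᴺ-minimal : ∀ t (g : Node t → ℚ) u → g (argminᴺ t g) ≤ g u
  argminᴺ-minimal (node s ts) g here = f[argmin]≤f[⊤] {f = g} here (minimisersBelow ts g)
  argminᴺ-minimal (node s ts) g (there i p) =
    ℚₚ.≤-trans (tabulate⁻ (f[argmin]≤f[xs] {f = g} here (minimisersBelow ts g)) i)
               (argminᴺ-minimal (ts i) (g ∘ there i) p)

∑ℕ : (n : ℕ) → (Fin n → ℕ) → ℕ
∑ℕ zero    f = 0
∑ℕ (suc n) f = f zero ℕ.+ ∑ℕ n (f ∘ suc)

∑ℕ-mono-≤ : ∀ n {f g : Fin n → ℕ} → (∀ i → f i ℕ.≤ g i) → ∑ℕ n f ℕ.≤ ∑ℕ n g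
∑ℕ-mono-≤ zero    f≤g = ℕ.z≤n
∑ℕ-mono-≤ (suc n) f≤g = ℕₚ.+-mono-≤ (f≤g zero) (∑ℕ-mono-≤ n (f≤g ∘ suc))

∑ℕ-mono-< : ∀ n {f g : Fin n → ℕ} → (∀ i → f i ℕ.≤ g i) → ∀ i → f i ℕ.< g i → ∑ℕ n f ℕ.< ∑ℕ n g
∑ℕ-mono-< (suc n) f≤g zero    fi<gi = ℕₚ.+-mono-<-≤ fi<gi (∑ℕ-mono-≤ n (f≤g ∘ suc))
∑ℕ-mono-< (suc n) f≤g (suc i) fi<gi = ℕₚ.+-mono-≤-< (f≤g zero) (∑ℕ-mono-< n (f≤g ∘ suc) i fi<gi)

∑ᴺ : (t : Tree) → (Node t → ℕ) → ℕ
∑ᴺ (node s ts) f = f here ℕ.+ ∑ℕ s (λ i → ∑ᴺ (ts i) (f ∘ there i))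

∑ᴺ-mono-≤ : ∀ t {f g : Node t → ℕ} → (∀ u → f u ℕ.≤ g u) → ∑ᴺ t f ℕ.≤ ∑ᴺ t g
∑ᴺ-mono-≤ (node s ts) f≤g =
  ℕₚ.+-mono-≤ (f≤g here) (∑ℕ-mono-≤ s (λ i → ∑ᴺ-mono-≤ (ts i) (f≤g ∘ there i)))

∑ᴺ-mono-< : ∀ t {f g : Node t → ℕ} → (∀ u → f u ℕ.≤ g u) → ∀ u → f u ℕ.< g u → ∑ᴺ t f ℕ.< ∑ᴺ t g
∑ᴺ-mono-< (node s ts) f≤g here fu<gu =
  ℕₚ.+-mono-<-≤ fu<gu (∑ℕ-mono-≤ s (λ i → ∑ᴺ-mono-≤ (ts i) (f≤g ∘ there i)))
∑ᴺ-mono-< (node s ts) f≤g (there i p) fu<gu =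
  ℕₚ.+-mono-≤-< (f≤g here)
    (∑ℕ-mono-< s (λ i → ∑ᴺ-mono-≤ (ts i) (f≤g ∘ there i)) i
                 (∑ᴺ-mono-< (ts i) (f≤g ∘ there i) p fu<gu))

-- Counting positive entries

support : ∀ {n} → (Fin n → ℚ) → Subset n
support f = tabulate λ j → ⌊ 0ℚ ℚₚ.<? f j ⌋

module _ {n} {f : Fin n → ℚ} {j : Fin n} where

  ∈-support⁺ : 0ℚ < f j → j ∈ˢ support f
  ∈-support⁺ 0<fj = lookup⇒[]= j _ (trans (lookup∘tabulate _ j) (⌊⌋-true (0ℚ ℚₚ.<? f j) 0<fj))

  ∈-support⁻ : j ∈ˢ support f → 0ℚ < f j
  ∈-support⁻ j∈ = ⌊⌋-true⁻¹ (0ℚ ℚₚ.<? f j) (trans (sym (lookup∘tabulate _ j)) ([]=⇒lookup j∈))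

module _ {n} {f g : Fin n → ℚ} (pos⇒pos : ∀ j → 0ℚ < f j → 0ℚ < g j) where

  support-⊆ : support f ⊆ support g
  support-⊆ j∈ = ∈-support⁺ (pos⇒pos _ (∈-support⁻ j∈))

  support-⊂ : ∀ j → ¬ 0ℚ < f j → 0ℚ < g j → support f ⊂ support g
  support-⊂ j fj≯0 0<gj = support-⊆ , j , ∈-support⁺ 0<gj , fj≯0 ∘ ∈-support⁻

positiveCount : ∀ {t} {m : Node t → ℕ} → ((u : Node t) → Fin (m u) → ℚ) → ℕ
positiveCount {t} f = ∑ᴺ t (λ u → ∣ support (f u) ∣)

positiveCount-< : ∀ {t} {m : Node t → ℕ} {f g : (u : Node t) → Fin (m u) → ℚ} →
                  (∀ u j → 0ℚ < f u j → 0ℚ < g u j) →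
                  ∀ u j → ¬ 0ℚ < f u j → 0ℚ < g u j → positiveCount f ℕ.< positiveCount g
positiveCount-< {t} pos⇒pos u j fuj≯0 0<guj =
  ∑ᴺ-mono-< t (λ u → p⊆q⇒∣p∣≤∣q∣ (support-⊆ (pos⇒pos u))) u
    (p⊂q⇒∣p∣<∣q∣ (support-⊂ (pos⇒pos u) j fuj≯0 0<guj))

-- Balanced vectors and soundness of 𝔏_A

module _ {t : Tree} (A : TreeAutomaton t) where
  open TreeAutomaton A

  infixl 6 _+ᵛ_
  infixl 7 _·ᵛ_
  infix  4 _≈ᵛ_

  _+ᵛ_ : Vector A → Vector A → Vector A
  μ +ᵛ ν = record
    { x = λ u a → x μ u a + x ν u a
    ; y = λ u q → y μ u q + y ν u q
    ; z = λ u j → z μ u j + z ν u j }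

  _·ᵛ_ : ℚ → Vector A → Vector A
  r ·ᵛ μ = record
    { x = λ u a → r * x μ u a
    ; y = λ u q → r * y μ u q
    ; z = λ u j → r * z μ u j }

  _≈ᵛ_ : Vector A → Vector A → Set
  μ ≈ᵛ ν = (∀ u a → x μ u a ≡ x ν u a)
         × (∀ u q → y μ u q ≡ y ν u q)
         × (∀ u j → z μ u j ≡ z ν u j)

  combination : (k : ℕ) → (Fin k → ℚ) → (Fin k → Term A) → (Fin k → StateMap A) → Vector A
  combination k λs τs ρs = record
    { x = λ u a → ∑ k (λ l → λs l * x (hat A (τs l) (ρs l)) u a)
    ; y = λ u q → ∑ k (λ l → λs l * y (hat A (τs l) (ρs l)) u q)
    ; z = λ u j → ∑ k (λ l → λs l * z (hat A (τs l) (ρs l)) u j) }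

  concludes : ∀ u → Fin (nQ u) → Fin (nΔ u) → Bool
  concludes u q j = ⌊ cnq (Δ u j) ≟ q ⌋

  hasAntecedent : ∀ u i → Fin (nQ (child u i)) → Fin (nΔ u) → Bool
  hasAntecedent u i q j = ⌊ ant (Δ u j) i ≟ q ⌋

  reads : ∀ u → Fin nΣ → Fin (nΔ u) → Bool
  reads u a j = ⌊ symb (Δ u j) ≟ a ⌋

  -- The constraints (ii)–(vi) of 𝔏_A, with c in place of 1 in (ii).
  record Balanced (μ : Vector A) (c : ℚ) : Set where
    constructor balanced
    field
      final-sum      : ∑[ F ∣ y μ root ] ≡ c
      nonfinal-zero  : ∀ q → F q ≡ false → y μ root q ≡ 0ℚ
      conclusion-sum : ∀ u q → ∑[ concludes u q ∣ z μ u ] ≡ y μ u q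
      antecedent-sum : ∀ u i q → ∑[ hasAntecedent u i q ∣ z μ u ] ≡ y μ (child u i) q
      symbol-sum     : ∀ u a → ∑[ reads u a ∣ z μ u ] ≡ x μ u a
  open Balanced

  Balanced-+ : ∀ {μ ν c d} → Balanced μ c → Balanced ν d → Balanced (μ +ᵛ ν) (c + d)
  final-sum      (Balanced-+ Bμ Bν) =
    trans (∑[]-distrib-+ F _ _) (cong₂ _+_ (final-sum Bμ) (final-sum Bν))
  nonfinal-zero  (Balanced-+ Bμ Bν) q Fq =
    trans (cong₂ _+_ (nonfinal-zero Bμ q Fq) (nonfinal-zero Bν q Fq)) (ℚₚ.+-identityʳ 0ℚ)
  conclusion-sum (Balanced-+ Bμ Bν) u q =
    trans (∑[]-distrib-+ (concludes u q) _ _)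
          (cong₂ _+_ (conclusion-sum Bμ u q) (conclusion-sum Bν u q))
  antecedent-sum (Balanced-+ Bμ Bν) u i q =
    trans (∑[]-distrib-+ (hasAntecedent u i q) _ _)
          (cong₂ _+_ (antecedent-sum Bμ u i q) (antecedent-sum Bν u i q))
  symbol-sum     (Balanced-+ Bμ Bν) u a =
    trans (∑[]-distrib-+ (reads u a) _ _) (cong₂ _+_ (symbol-sum Bμ u a) (symbol-sum Bν u a))

  Balanced-· : ∀ {μ c} r → Balanced μ c → Balanced (r ·ᵛ μ) (r * c)
  final-sum      (Balanced-· r B) = trans (∑[]-* F r _) (cong (r *_) (final-sum B))
  nonfinal-zero  (Balanced-· r B) q Fq = trans (cong (r *_) (nonfinal-zero B q Fq)) (ℚₚ.*-zeroʳ r)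
  conclusion-sum (Balanced-· r B) u q =
    trans (∑[]-* (concludes u q) r _) (cong (r *_) (conclusion-sum B u q))
  antecedent-sum (Balanced-· r B) u i q =
    trans (∑[]-* (hasAntecedent u i q) r _) (cong (r *_) (antecedent-sum B u i q))
  symbol-sum     (Balanced-· r B) u a =
    trans (∑[]-* (reads u a) r _) (cong (r *_) (symbol-sum B u a))

  Balanced-≈ : ∀ {μ ν c} → μ ≈ᵛ ν → Balanced ν c → Balanced μ c
  final-sum      (Balanced-≈ (_ , μy , _) B) = trans (∑[]-cong F (μy root)) (final-sum B)
  nonfinal-zero  (Balanced-≈ (_ , μy , _) B) q Fq = trans (μy root q) (nonfinal-zero B q Fq)
  conclusion-sum (Balanced-≈ (_ , μy , μz) B) u q =
    trans (∑[]-cong (concludes u q) (μz u)) (trans (conclusion-sum B u q) (sym (μy u q)))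
  antecedent-sum (Balanced-≈ (_ , μy , μz) B) u i q =
    trans (∑[]-cong (hasAntecedent u i q) (μz u))
          (trans (antecedent-sum B u i q) (sym (μy (child u i) q)))
  symbol-sum     (Balanced-≈ (μx , _ , μz) B) u a =
    trans (∑[]-cong (reads u a) (μz u)) (trans (symbol-sum B u a) (sym (μx u a)))

  module TraceVector {τ : Term A} {ρ : StateMap A} (trace : IsTrace A τ ρ) where

    transitionAt : (u : Node t) → Fin (nΔ u)
    transitionAt u = proj₁ (trace u)

    fits-transitionAt : ∀ u → Fits A τ ρ u (Δ u (transitionAt u))
    fits-transitionAt u = proj₂ (trace u)

    fits⇔transitionAt : ∀ u j → Fits A τ ρ u (Δ u j) ⇔ transitionAt u ≡ j
    fits⇔transitionAt u j =
      mk⇔ (Δ-distinct u (transitionAt u) j ∘ same (fits-transitionAt u))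
          (λ { refl → fits-transitionAt u })
      where
      same : ∀ {δ δ′} → Fits A τ ρ u δ → Fits A τ ρ u δ′ → SameTransition δ δ′
      same (ant≡ , symb≡ , cnq≡) (ant≡′ , symb≡′ , cnq≡′) =
        (λ i → trans (ant≡ i) (sym (ant≡′ i))) , trans symb≡ (sym symb≡′) , trans cnq≡ (sym cnq≡′)

    z-hat : ∀ u j → z (hat A τ ρ) u j ≡ indicator ⌊ transitionAt u ≟ j ⌋
    z-hat u j = cong indicator (begin
      ⌊ fits?′ ⌋                 ≡⟨ isYes≗does fits?′ ⟩
      does fits?′                ≡⟨ does-⇔ (fits⇔transitionAt u j) fits?′ (transitionAt u ≟ j) ⟩
      does (transitionAt u ≟ j)  ≡⟨ isYes≗does (transitionAt u ≟ j) ⟨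
      ⌊ transitionAt u ≟ j ⌋     ∎)
      where
      open ≡-Reasoning
      fits?′ : Dec (Fits A τ ρ u (Δ u j))
      fits?′ = fits? A τ ρ u (Δ u j)

    ∑[≟]-z-hat : ∀ u {m} (f : Fin (nΔ u) → Fin m) {w} → f (transitionAt u) ≡ w → ∀ q →
                 ∑[ (λ j → ⌊ f j ≟ q ⌋) ∣ z (hat A τ ρ) u ] ≡ indicator ⌊ w ≟ q ⌋
    ∑[≟]-z-hat u f {w} f[d]≡w q = begin
      ∑[ sel ∣ z (hat A τ ρ) u ]
        ≡⟨ ∑[]-cong sel (z-hat u) ⟩
      ∑[ sel ∣ (λ j → indicator ⌊ transitionAt u ≟ j ⌋) ]
        ≡⟨ ∑[]-indicator sel (transitionAt u) ⟩
      indicator ⌊ f (transitionAt u) ≟ q ⌋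
        ≡⟨ cong (λ v → indicator ⌊ v ≟ q ⌋) f[d]≡w ⟩
      indicator ⌊ w ≟ q ⌋
        ∎
      where
      open ≡-Reasoning
      sel : Fin (nΔ u) → Bool
      sel j = ⌊ f j ≟ q ⌋

    Balanced-hat : F (ρ root) ≡ true → Balanced (hat A τ ρ) 1ℚ
    final-sum      (Balanced-hat accept) =
      trans (∑[]-indicator F (ρ root)) (cong indicator accept)
    nonfinal-zero  (Balanced-hat accept) q Fq =
      cong indicator (⌊⌋-false (ρ root ≟ q) λ { refl → contradiction (trans (sym accept) Fq) λ () })
    conclusion-sum (Balanced-hat _) u q =
      ∑[≟]-z-hat u (cnq ∘ Δ u) (proj₂ (proj₂ (fits-transitionAt u))) q
    antecedent-sum (Balanced-hat _) u i q =
      ∑[≟]-z-hat u (λ j → ant (Δ u j) i) (proj₁ (fits-transitionAt u) i) q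
    symbol-sum     (Balanced-hat _) u a =
      ∑[≟]-z-hat u (symb ∘ Δ u) (proj₁ (proj₂ (fits-transitionAt u))) a

  Balanced-combination : ∀ k λs τs ρs → (∀ l → IsAcceptingTrace A (τs l) (ρs l)) →
                         Balanced (combination k λs τs ρs) (∑ k λs)
  Balanced-combination zero λs τs ρs accepting = balanced
    (∑[]-zero F (λ _ → refl)) (λ _ _ → refl)
    (λ u q → ∑[]-zero (concludes u q) (λ _ → refl))
    (λ u i q → ∑[]-zero (hasAntecedent u i q) (λ _ → refl))
    (λ u a → ∑[]-zero (reads u a) (λ _ → refl))
  Balanced-combination (suc k) λs τs ρs accepting =
    subst (Balanced _) (cong (_+ ∑ k (λs ∘ suc)) (ℚₚ.*-identityʳ (λs zero)))
      (Balanced-+ (Balanced-· (λs zero) (Balanced-hat (proj₂ (accepting zero))))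
                  (Balanced-combination k (λs ∘ suc) (τs ∘ suc) (ρs ∘ suc) (accepting ∘ suc)))
    where open TraceVector (proj₁ (accepting zero)) using (Balanced-hat)

  InPex⇒Satisfies𝔏 : ∀ μ → InPex A μ → Satisfies𝔏 A μ
  InPex⇒Satisfies𝔏 μ (k , λs , τs , ρs , accepting , λs≥0 , ∑λs≡1 , μ≈) =
    ( (λ u a → in-unit-interval (λ l → ⌊ τs l u ≟ a ⌋) (proj₁ μ≈ u a))
    , (λ u q → in-unit-interval (λ l → ⌊ ρs l u ≟ q ⌋) (proj₁ (proj₂ μ≈) u q))
    , (λ u j → in-unit-interval (λ l → ⌊ fits? A (τs l) (ρs l) u (Δ u j) ⌋) (proj₂ (proj₂ μ≈) u j)))
    , final-sum B , nonfinal-zero B , conclusion-sum B , antecedent-sum B , symbol-sum B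
    where
    B : Balanced μ 1ℚ
    B = Balanced-≈ μ≈ (subst (Balanced _) ∑λs≡1 (Balanced-combination k λs τs ρs accepting))

    in-unit-interval : ∀ {w} bs → w ≡ ∑ k (λ l → λs l * indicator (bs l)) → 0ℚ ≤ w × w ≤ 1ℚ
    in-unit-interval bs refl = convex-indicator-bounds k λs bs λs≥0 ∑λs≡1

  -- Decomposition of the solutions of 𝔏_A

  -- For a balanced vector the x- and y-coordinates are sums of z-coordinates, so the
  -- peeling only has to preserve nonnegativity of z.
  NonNegativeᶻ : Vector A → Set
  NonNegativeᶻ μ = ∀ u j → 0ℚ ≤ z μ u j

  Decomposition : Vector A → ℚ → Set
  Decomposition μ c =
    ∃[ k ] Σ (Fin k → ℚ) λ λs → Σ (Fin k → Term A) λ τs → Σ (Fin k → StateMap A) λ ρs →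
      (∀ l → IsAcceptingTrace A (τs l) (ρs l)) × (∀ l → 0ℚ ≤ λs l) × (∑ k λs ≡ c)
    × μ ≈ᵛ combination k λs τs ρs

  record PositiveTrace (μ : Vector A) : Set where
    field
      term      : Term A
      states    : StateMap A
      accepting : IsAcceptingTrace A term states
      positive  : ∀ u → 0ℚ < z μ u (proj₁ (proj₁ accepting u))

  module _ {μ c} (B : Balanced μ c) (z≥0 : NonNegativeᶻ μ) where

    y-nonneg : ∀ u q → 0ℚ ≤ y μ u q
    y-nonneg u q = subst (0ℚ ≤_) (conclusion-sum B u q) (∑[]-nonneg (concludes u q) (z≥0 u))

    z-vanishes-below : ∀ u → (∀ q → y μ u q ≡ 0ℚ) → ∀ j → z μ u j ≡ 0ℚ
    z-vanishes-below u y≡0 j = ℚₚ.≤-antisym (begin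
      z μ u j                      ≤⟨ term≤∑[] (concludes u q) (z≥0 u) j (⌊⌋-true (q ≟ q) refl) ⟩
      ∑[ concludes u q ∣ z μ u ]   ≡⟨ conclusion-sum B u q ⟩
      y μ u q                      ≡⟨ y≡0 q ⟩
      0ℚ                           ∎) (z≥0 u j)
      where
      open ℚₚ.≤-Reasoning
      q : Fin (nQ u)
      q = cnq (Δ u j)

    y-vanishes : c ≤ 0ℚ → ∀ u q → y μ u q ≡ 0ℚ
    y-vanishes c≤0 = topDown (λ u → ∀ q → y μ u q ≡ 0ℚ) root-vanishes λ u i y≡0 q →
      trans (sym (antecedent-sum B u i q)) (∑[]-zero (hasAntecedent u i q) (z-vanishes-below u y≡0))
      where
      root-vanishes : ∀ q → y μ root q ≡ 0ℚ
      root-vanishes q with F q in Fq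
      ... | false = nonfinal-zero B q Fq
      ... | true  = ℚₚ.≤-antisym (begin
        y μ root q          ≤⟨ term≤∑[] F (y-nonneg root) q Fq ⟩
        ∑[ F ∣ y μ root ]   ≡⟨ final-sum B ⟩
        c                   ≤⟨ c≤0 ⟩
        0ℚ                  ∎) (y-nonneg root q)
        where open ℚₚ.≤-Reasoning

    nonpositive-decomposition : c ≤ 0ℚ → Decomposition μ c
    nonpositive-decomposition c≤0 =
      0 , (λ ()) , (λ ()) , (λ ()) , (λ ()) , (λ ()) , sym c≡0 , x≡0 , y≡0 , z≡0
      where
      y≡0 : ∀ u q → y μ u q ≡ 0ℚ
      y≡0 = y-vanishes c≤0
      z≡0 : ∀ u j → z μ u j ≡ 0ℚ
      z≡0 u = z-vanishes-below u (y≡0 u)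
      x≡0 : ∀ u a → x μ u a ≡ 0ℚ
      x≡0 u a = trans (sym (symbol-sum B u a)) (∑[]-zero (reads u a) (z≡0 u))
      c≡0 : c ≡ 0ℚ
      c≡0 = trans (sym (final-sum B)) (∑[]-zero F (y≡0 root))

    positive-final : 0ℚ < c → ∃[ q ] (F q ≡ true × 0ℚ < y μ root q)
    positive-final 0<c = ∑[]-positive-term F (subst (0ℚ <_) (sym (final-sum B)) 0<c)

    positive-transition : ∀ u q → 0ℚ < y μ u q → ∃[ j ] (cnq (Δ u j) ≡ q × 0ℚ < z μ u j)
    positive-transition u q 0<y =
      let (j , concludes-q , 0<z) =
            ∑[]-positive-term (concludes u q) (subst (0ℚ <_) (sym (conclusion-sum B u q)) 0<y)
      in j , ⌊⌋-true⁻¹ (cnq (Δ u j) ≟ q) concludes-q , 0<z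

    positive-antecedent : ∀ u i j → 0ℚ < z μ u j → 0ℚ < y μ (child u i) (ant (Δ u j) i)
    positive-antecedent u i j 0<z = ℚₚ.<-≤-trans 0<z (begin
      z μ u j
        ≤⟨ term≤∑[] (hasAntecedent u i q) (z≥0 u) j (⌊⌋-true (q ≟ q) refl) ⟩
      ∑[ hasAntecedent u i q ∣ z μ u ]
        ≡⟨ antecedent-sum B u i q ⟩
      y μ (child u i) q
        ∎)
      where
      open ℚₚ.≤-Reasoning
      q : Fin (nQ (child u i))
      q = ant (Δ u j) i

    positiveTrace : 0ℚ < c → PositiveTrace μ
    positiveTrace 0<c = record
      { term = τ ; states = ρ ; accepting = trace , accept ; positive = proj₂ ∘ proj₂ ∘ transition }
      where
      PositiveState : Node t → Set
      PositiveState u = ∃[ q ] 0ℚ < y μ u q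

      final : ∃[ q ] (F q ≡ true × 0ℚ < y μ root q)
      final = positive-final 0<c

      descend : ∀ u i → PositiveState u → PositiveState (child u i)
      descend u i (q , 0<y) =
        let (j , _ , 0<z) = positive-transition u q 0<y
        in ant (Δ u j) i , positive-antecedent u i j 0<z

      state : ∀ u → PositiveState u
      state = topDown PositiveState (proj₁ final , proj₂ (proj₂ final)) descend

      ρ : StateMap A
      ρ u = proj₁ (state u)

      transition : ∀ u → ∃[ j ] (cnq (Δ u j) ≡ ρ u × 0ℚ < z μ u j)
      transition u = positive-transition u (ρ u) (proj₂ (state u))

      τ : Term A
      τ u = symb (Δ u (proj₁ (transition u)))

      trace : IsTrace A τ ρ
      trace u = proj₁ (transition u)
        , (λ i → sym (cong proj₁ (topDown-child PositiveState _ descend u i)))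
        , refl
        , proj₁ (proj₂ (transition u))

      accept : F (ρ root) ≡ true
      accept = trans (cong (F ∘ proj₁) (topDown-root PositiveState _ descend)) (proj₁ (proj₂ final))

  module Peel {μ c} (B : Balanced μ c) (z≥0 : NonNegativeᶻ μ) (P : PositiveTrace μ) where
    open PositiveTrace P
    open TraceVector (proj₁ accepting) using (transitionAt; z-hat; Balanced-hat)

    ĥ : Vector A
    ĥ = hat A term states

    weight : Node t → ℚ
    weight u = z μ u (transitionAt u)

    bottleneck : Node t
    bottleneck = argminᴺ t weight

    ε : ℚ
    ε = weight bottleneck

    0≤ε : 0ℚ ≤ ε
    0≤ε = ℚₚ.<⇒≤ (positive bottleneck)

    μ′ : Vector A
    μ′ = μ +ᵛ (- ε) ·ᵛ ĥ

    μ′-balanced : Balanced μ′ (c - ε)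
    μ′-balanced = subst (Balanced μ′) (cong (c +_) (ℚₚ.*-identityʳ (- ε)))
      (Balanced-+ B (Balanced-· (- ε) (Balanced-hat (proj₂ accepting))))

    z-μ′ : ∀ u j → z μ′ u j ≡ (if ⌊ transitionAt u ≟ j ⌋ then z μ u j - ε else z μ u j)
    z-μ′ u j = trans (cong (λ h → z μ u j + - ε * h) (z-hat u j)) (subtract-indicator (z μ u j) ε _)

    μ′-nonneg : NonNegativeᶻ μ′
    μ′-nonneg u j rewrite z-μ′ u j with transitionAt u ≟ j
    ... | yes refl = q≤p⇒0≤p-q (argminᴺ-minimal t weight u)
    ... | no  _    = z≥0 u j

    z-μ′≤z-μ : ∀ u j → z μ′ u j ≤ z μ u j
    z-μ′≤z-μ u j rewrite z-μ′ u j with transitionAt u ≟ j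
    ... | yes _ = 0≤q⇒p-q≤p 0≤ε
    ... | no  _ = ℚₚ.≤-refl

    z-μ′-bottleneck : z μ′ bottleneck (transitionAt bottleneck) ≡ 0ℚ
    z-μ′-bottleneck = begin
      z μ′ bottleneck d                   ≡⟨ z-μ′ bottleneck d ⟩
      (if ⌊ d ≟ d ⌋ then ε - ε else ε)    ≡⟨ cong (if_then ε - ε else ε) (⌊⌋-true (d ≟ d) refl) ⟩
      ε - ε                               ≡⟨ ℚₚ.+-inverseʳ ε ⟩
      0ℚ                                  ∎
      where
      open ≡-Reasoning
      d : Fin (nΔ bottleneck)
      d = transitionAt bottleneck

    fewer-positives : positiveCount (z μ′) ℕ.< positiveCount (z μ)
    fewer-positives =
      positiveCount-< (λ u j 0<z′ → ℚₚ.<-≤-trans 0<z′ (z-μ′≤z-μ u j))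
        bottleneck (transitionAt bottleneck)
        (ℚₚ.<-irrefl (sym z-μ′-bottleneck)) (positive bottleneck)

    extend : Decomposition μ′ (c - ε) → Decomposition μ c
    extend (k , λs , τs , ρs , accepting′ , λs≥0 , ∑λs , μ′x , μ′y , μ′z) =
      suc k , ε ∷ λs , term ∷ τs , states ∷ ρs
      , (λ { zero → accepting ; (suc l) → accepting′ l })
      , (λ { zero → 0≤ε ; (suc l) → λs≥0 l })
      , trans (cong (ε +_) ∑λs) (p+[q-p]≡q ε c)
      , (λ u a → trans (p≡q*r+[p+-q*r] (x μ u a) ε (x ĥ u a)) (cong (ε * x ĥ u a +_) (μ′x u a)))
      , (λ u q → trans (p≡q*r+[p+-q*r] (y μ u q) ε (y ĥ u q)) (cong (ε * y ĥ u q +_) (μ′y u q)))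
      , (λ u j → trans (p≡q*r+[p+-q*r] (z μ u j) ε (z ĥ u j)) (cong (ε * z ĥ u j +_) (μ′z u j)))

  decompose : ∀ {μ c} → Acc ℕ._<_ (positiveCount (z μ)) →
              Balanced μ c → NonNegativeᶻ μ → Decomposition μ c
  decompose {μ} {c} (acc smaller) B z≥0 with 0ℚ ℚₚ.<? c
  ... | no  c≯0 = nonpositive-decomposition B z≥0 (ℚₚ.≮⇒≥ c≯0)
  ... | yes 0<c = extend (decompose (smaller fewer-positives) μ′-balanced μ′-nonneg)
    where open Peel B z≥0 (positiveTrace B z≥0 0<c)

  Satisfies𝔏⇒InPex : ∀ μ → Satisfies𝔏 A μ → InPex A μ
  Satisfies𝔏⇒InPex μ ((_ , _ , z∈[0,1]) , ii , iii , iv , v , vi) =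
    decompose (<-wellFounded _) (balanced ii iii iv v vi) (λ u j → proj₁ (z∈[0,1] u j))

theorem4p4 : {t : Tree} (A : TreeAutomaton t) (μ : Vector A) → InPex A μ ⇔ Satisfies𝔏 A μ
theorem4p4 A μ = mk⇔ (InPex⇒Satisfies𝔏 A μ) (Satisfies𝔏⇒InPex A μ)
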